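{- Let $C\subset\mathbb{Z}_2^n$ be a $5$-cap and let $y$ be the sum of the five elements of $C$. Then: (a) $\mathrm{qc}(C)\cup\{y\}$ is a $4$-flat, and $y\notin\mathrm{qc}(C)$ (the union is disjoint); (b) $C$ is not complete, and $C$ is not contained in any flat of dimension less than $4$; (c) every point of $\mathrm{exc}(C\cup\{y\})$ has multiplicity $2$ with respect to $C\cup\{y\}$.
   Context: $\mathbb{Z}_2^n$ is the $n$-dimensional vector space over $\mathbb{Z}_2$. A quad is a set of four distinct elements $a,b,c,d$ with $a+b+c+d=\vec 0$; a cap is a subset containing no quad; a $k$-cap is a cap with $k$ elements. A cap $C$ is complete if adding any other element of $\mathbb{Z}_2^n$ to $C$ yields a set that is not a cap. For $S\subset\mathbb{Z}_2^n$, $\mathrm{exc}(S)=\{a+b+c: a,b,c\in S\text{ distinct}\}$ and $\mathrm{qc}(S)=S\cup\mathrm{exc}(S)$; the multiplicity of $p\in\mathrm{exc}(S)$ is the number of $3$-element subsets $\{x,y,z\}\subset S$ with $x+y+z=p$. An $r$-flat is an $r$-dimensional affine subspace of $\mathbb{Z}_2^n$ (it has $2^r$ points). -}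

module Defs where

open import Data.Bool using (Bool; true; false; if_then_else_; _xor_)
open import Data.Bool.Properties using () renaming (_≟_ to _≟B_)
open import Data.Nat using (ℕ; zero; suc; _<_)
open import Data.Fin using (Fin; zero; suc)
open import Data.Vec using (Vec; replicate; zipWith)
import Data.Vec.Properties as VecP
open import Data.List using (List; []; _∷_; map; _++_; filter; length; foldr)
open import Data.List.Membership.Propositional using (_∈_; _∉_)
open import Data.List.Relation.Unary.All using (All)
open import Data.Product using (Σ; ∃; _×_; _,_)
open import Data.Sum using (_⊎_)
open import Relation.Binary.PropositionalEquality using (_≡_; _≢_)
open import Relation.Nullary using (¬_; Dec)

V : ℕ → Set
V n = Vec Bool n

_⊕_ : ∀ {n} → V n → V n → V n
_⊕_ = zipWith _xor_
infixl 6 _⊕_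

0̂ : ∀ {n} → V n
0̂ = replicate _ false

_≟V_ : ∀ {n} (x y : V n) → Dec (x ≡ y)
_≟V_ = VecP.≡-dec _≟B_

Subset : ℕ → Set₁
Subset n = V n → Set

IsQuad : ∀ {n} → V n → V n → V n → V n → Set
IsQuad a b c d =
  a ≢ b × a ≢ c × a ≢ d × b ≢ c × b ≢ d × c ≢ d × (a ⊕ b ⊕ c ⊕ d ≡ 0̂)

IsCap : ∀ {n} → Subset n → Set
IsCap S = ∀ a b c d → S a → S b → S c → S d → ¬ IsQuad a b c d

-- finite sets given as duplicate-free lists; the subset they denote
⟦_⟧ : ∀ {n} → List (V n) → Subset n
⟦ C ⟧ x = x ∈ C

IsComplete : ∀ {n} → List (V n) → Set
IsComplete C = ∀ x → x ∉ C → ¬ IsCap ⟦ x ∷ C ⟧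

sumL : ∀ {n} → List (V n) → V n
sumL = foldr _⊕_ 0̂

exc : ∀ {n} → Subset n → Subset n
exc S p = ∃ λ a → ∃ λ b → ∃ λ c →
  S a × S b × S c × a ≢ b × a ≢ c × b ≢ c × (a ⊕ b ⊕ c ≡ p)

qc : ∀ {n} → Subset n → Subset n
qc S p = S p ⊎ exc S p

lincomb : ∀ {n} (r : ℕ) → (Fin r → Bool) → (Fin r → V n) → V n
lincomb zero    l v = 0̂
lincomb (suc r) l v =
  (if l zero then v zero else 0̂) ⊕ lincomb r (λ i → l (suc i)) (λ i → v (suc i))

LinIndep : ∀ {n} (r : ℕ) → (Fin r → V n) → Set
LinIndep r v = ∀ l → lincomb r l v ≡ 0̂ → ∀ i → l i ≡ false

IsFlat : ∀ {n} (r : ℕ) → Subset n → Set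
IsFlat {n} r F = Σ (V n) λ p → Σ (Fin r → V n) λ v →
  LinIndep r v × (∀ x → (F x → ∃ λ l → x ≡ p ⊕ lincomb r l v)
                      × ((∃ λ l → x ≡ p ⊕ lincomb r l v) → F x))

-- all 3-element sublists (3-element subsets of a duplicate-free list)
pairs : ∀ {A : Set} → List A → List (A × A)
pairs []       = []
pairs (x ∷ xs) = map (λ y → x , y) xs ++ pairs xs

triples : ∀ {A : Set} → List A → List (A × A × A)
triples []       = []
triples (x ∷ xs) = map (λ { (y , z) → x , y , z }) (pairs xs) ++ triples xs

multiplicity : ∀ {n} → List (V n) → V n → ℕ
multiplicity S p =
  length (filter (λ { (x , y , z) → (x ⊕ y ⊕ z) ≟V p }) (triples S))

-- Write σ l = Σᵢ lᵢ cᵢ for l ∈ Z₂⁵. A nonzero l of even weight has weight 2 or 4, so σ l ≠ 0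
-- because the points are distinct and C has no quad; hence σ is injective on each parity
-- class. The odd-weight combinations (weights 1, 3, 5) give exactly C, exc(C)
-- and y, and form the flat c₀ + span(c₀ + cᵢ) whose four directions are independent; in
-- particular y ∉ qc(C). A quad of C ∪ {y} through y would put y in exc(C), so C ∪ {y} is a
-- cap. A flat of dimension r < 4 through C would contain those 2⁴ distinct points among its
-- 2ʳ. Finally the six vectors 1, e₁, …, e₅ representing C ∪ {y} sum to zero and satisfy no
-- other relation, so every triple sum is attained by exactly two triples: a triple and its
-- complement.

module Submission where

open import Defs
open import Algebra.Bundles using (AbelianGroup; CommutativeRing)
import Algebra.Properties.CommutativeSemigroup
import Algebra.Properties.Group
open import Data.Bool using (Bool; true; false; not; _∧_; _xor_; if_then_else_)
open import Data.Bool.Properties as B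
  using (xor-assoc; xor-comm; xor-same; xor-identityˡ; xor-identityʳ; xor-∧-commutativeRing)
open import Data.Empty using (⊥-elim)
open import Data.Fin using (Fin; zero; suc; combine; funToFin; finToFun; #_)
open import Data.Fin.Properties as F using (all?; pigeonhole; finToFun-funToFin; funToFin-finToFin; <⇒≢)
open import Data.List using (List; []; _∷_; lookup; length; filter; map; allFin)
open import Data.List.Membership.Propositional using (_∈_)
open import Data.List.Membership.Propositional.Properties using (∈-lookup)
open import Data.List.Relation.Unary.All as All using (All)
open import Data.List.Relation.Unary.AllPairs using (_∷_)
open import Data.List.Relation.Unary.Any as Any using (here; there)
open import Data.List.Relation.Unary.Any.Properties using (lookup-index)
open import Data.List.Relation.Unary.Unique.Propositional using (Unique)
open import Data.Nat using (ℕ; zero; suc; _≤_; _<_; _^_; s≤s; z≤n)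
open import Data.Nat.Properties as N using (^-monoʳ-<; ≮⇒≥; ≤⇒≯)
open import Data.Product using (Σ; ∃; _×_; _,_; proj₁; proj₂)
open import Data.Sum using (_⊎_; inj₁; inj₂; [_,_]′)
open import Data.Unit using (tt)
open import Data.Vec as Vec using (Vec; []; _∷_)
open import Data.Vec.Properties
  using (lookup∘tabulate; lookup-replicate; zipWith-assoc; zipWith-comm; zipWith-identityˡ; zipWith-identityʳ)
open import Data.Vec.Functional using () renaming (_∷_ to _◂_)
open import Function using (_∘_)
open import Level using (0ℓ)
open import Relation.Binary.PropositionalEquality
  using (_≡_; _≢_; refl; sym; trans; cong; cong₂; subst; isEquivalence; ≢-sym; module ≡-Reasoning)
open import Relation.Nullary using (¬_; yes; no)
open import Relation.Nullary.Decidable using (toWitness; _⊎-dec_; ¬?)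
open import Relation.Unary using (Pred; Decidable)

⊕-inverse : ∀ {n} (x : V n) → x ⊕ x ≡ 0̂
⊕-inverse []      = refl
⊕-inverse (a ∷ x) = cong₂ _∷_ (xor-same a) (⊕-inverse x)

⊕-abelianGroup : ℕ → AbelianGroup _ _
⊕-abelianGroup n = record
  { Carrier = V n
  ; _≈_ = _≡_
  ; _∙_ = _⊕_
  ; ε = 0̂
  ; _⁻¹ = λ x → x
  ; isAbelianGroup = record
    { isGroup = record
      { isMonoid = record
        { isSemigroup = record
          { isMagma = record { isEquivalence = isEquivalence ; ∙-cong = cong₂ _⊕_ }
          ; assoc = zipWith-assoc xor-assoc
          }
        ; identity = zipWith-identityˡ xor-identityˡ , zipWith-identityʳ xor-identityʳ
        }
      ; inverse = ⊕-inverse , ⊕-inverse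
      ; ⁻¹-cong = λ eq → eq
      }
    ; comm = zipWith-comm xor-comm
    }
  }

module ⊕ {n : ℕ} where
  open AbelianGroup (⊕-abelianGroup n) public
    using (assoc; comm; identityˡ; identityʳ)
  open Algebra.Properties.CommutativeSemigroup
    (AbelianGroup.commutativeSemigroup (⊕-abelianGroup n)) public
    using (interchange; xy∙z≈xz∙y)
  open Algebra.Properties.Group (AbelianGroup.group (⊕-abelianGroup n)) public
    using (inverseˡ-unique)

IsQuad-swapʳ : ∀ {n} {a b c d : V n} → IsQuad a b c d → IsQuad a b d c
IsQuad-swapʳ {a = a} {b} {c} {d} (a≢b , a≢c , a≢d , b≢c , b≢d , c≢d , sum) =
  a≢b , a≢d , a≢c , b≢d , b≢c , ≢-sym c≢d , trans (⊕.xy∙z≈xz∙y (a ⊕ b) d c) sum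

IsQuad-rotate : ∀ {n} {a b c d : V n} → IsQuad a b c d → IsQuad b c d a
IsQuad-rotate {a = a} {b} {c} {d} (a≢b , a≢c , a≢d , b≢c , b≢d , c≢d , sum) =
  b≢c , b≢d , ≢-sym a≢b , c≢d , ≢-sym a≢c , ≢-sym a≢d , (begin
    b ⊕ c ⊕ d ⊕ a       ≡⟨ ⊕.comm (b ⊕ c ⊕ d) a ⟩
    a ⊕ (b ⊕ c ⊕ d)     ≡⟨ sym (⊕.assoc a (b ⊕ c) d) ⟩
    a ⊕ (b ⊕ c) ⊕ d     ≡⟨ cong (_⊕ d) (sym (⊕.assoc a b c)) ⟩
    a ⊕ b ⊕ c ⊕ d       ≡⟨ sum ⟩
    0̂                   ∎)
  where open ≡-Reasoning

module xor = Algebra.Properties.CommutativeSemigroup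
  (AbelianGroup.commutativeSemigroup (CommutativeRing.+-abelianGroup xor-∧-commutativeRing))

xor≡false⇒≡ : ∀ {a b} → a xor b ≡ false → a ≡ b
xor≡false⇒≡ {true}  {true}  _ = refl
xor≡false⇒≡ {false} {false} _ = refl

xor≡true⇒≡not : ∀ {a b} → a xor b ≡ true → a ≡ not b
xor≡true⇒≡not {true}  {false} _ = refl
xor≡true⇒≡not {false} {true}  _ = refl

_⊻_ : ∀ {r} → (Fin r → Bool) → (Fin r → Bool) → Fin r → Bool
(u ⊻ w) i = u i xor w i
infixl 6 _⊻_

parity : ∀ {r} → (Fin r → Bool) → Bool
parity {zero}  l = false
parity {suc r} l = l zero xor parity (l ∘ suc)

unit : ∀ {r} → Fin r → Fin r → Bool
unit zero    zero    = true
unit zero    (suc _) = false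
unit (suc _) zero    = false
unit (suc i) (suc j) = unit i j

parity-⊻ : ∀ {r} (u w : Fin r → Bool) → parity (u ⊻ w) ≡ parity u xor parity w
parity-⊻ {zero}  u w = refl
parity-⊻ {suc r} u w = trans (cong ((u zero xor w zero) xor_) (parity-⊻ (u ∘ suc) (w ∘ suc)))
                             (xor.interchange (u zero) (w zero) _ _)

parity-false : ∀ {r} → parity {r} (λ _ → false) ≡ false
parity-false {zero}  = refl
parity-false {suc r} = parity-false {r}

parity-cong : ∀ {r} {u w : Fin r → Bool} → (∀ i → u i ≡ w i) → parity u ≡ parity w
parity-cong {zero}  eq = refl
parity-cong {suc r} eq = cong₂ _xor_ (eq zero) (parity-cong (eq ∘ suc))

parity-unit : ∀ {r} (i : Fin r) → parity (unit i) ≡ true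
parity-unit {suc r} zero    = cong not (parity-false {r})
parity-unit {suc r} (suc i) = parity-unit i

parity-odd₃ : ∀ {r} (u v w : Fin r → Bool) → parity u ≡ true → parity v ≡ true → parity w ≡ true →
  parity (u ⊻ v ⊻ w) ≡ true
parity-odd₃ u v w odd-u odd-v odd-w =
  trans (parity-⊻ (u ⊻ v) w) (cong₂ _xor_ (trans (parity-⊻ u v) (cong₂ _xor_ odd-u odd-v)) odd-w)

select : ∀ {n} → Bool → V n → V n
select b x = if b then x else 0̂

select-xor : ∀ {n} a b (x : V n) → select (a xor b) x ≡ select a x ⊕ select b x
select-xor true  true  x = sym (⊕-inverse x)
select-xor true  false x = sym (⊕.identityʳ x)
select-xor false b     x = sym (⊕.identityˡ _)

select-⊕ : ∀ {n} b (x y : V n) → select b (x ⊕ y) ≡ select b x ⊕ select b y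
select-⊕ true  x y = refl
select-⊕ false x y = sym (⊕.identityˡ 0̂)

lincomb-cong : ∀ {n} r {l l′ : Fin r → Bool} (v : Fin r → V n) →
  (∀ i → l i ≡ l′ i) → lincomb r l v ≡ lincomb r l′ v
lincomb-cong zero    v eq = refl
lincomb-cong (suc r) v eq =
  cong₂ _⊕_ (cong (λ b → select b (v zero)) (eq zero)) (lincomb-cong r (v ∘ suc) (eq ∘ suc))

lincomb-congᵥ : ∀ {n} r (l : Fin r → Bool) {v v′ : Fin r → V n} →
  (∀ i → v i ≡ v′ i) → lincomb r l v ≡ lincomb r l v′
lincomb-congᵥ zero    l eq = refl
lincomb-congᵥ (suc r) l eq =
  cong₂ _⊕_ (cong (select (l zero)) (eq zero)) (lincomb-congᵥ r (l ∘ suc) (eq ∘ suc))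

lincomb-zero : ∀ {n} r {l : Fin r → Bool} (v : Fin r → V n) →
  (∀ i → l i ≡ false) → lincomb r l v ≡ 0̂
lincomb-zero zero    v eq = refl
lincomb-zero (suc r) v eq =
  trans (cong₂ _⊕_ (cong (λ b → select b (v zero)) (eq zero)) (lincomb-zero r (v ∘ suc) (eq ∘ suc)))
        (⊕.identityˡ 0̂)

lincomb-⊻ : ∀ {n} r (l l′ : Fin r → Bool) (v : Fin r → V n) →
  lincomb r (l ⊻ l′) v ≡ lincomb r l v ⊕ lincomb r l′ v
lincomb-⊻ zero    l l′ v = sym (⊕.identityˡ 0̂)
lincomb-⊻ (suc r) l l′ v = begin
  select (l zero xor l′ zero) (v zero) ⊕ lincomb r (l ∘ suc ⊻ l′ ∘ suc) (v ∘ suc)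
    ≡⟨ cong₂ _⊕_ (select-xor (l zero) (l′ zero) (v zero)) (lincomb-⊻ r (l ∘ suc) (l′ ∘ suc) (v ∘ suc)) ⟩
  (select (l zero) (v zero) ⊕ select (l′ zero) (v zero))
    ⊕ (lincomb r (l ∘ suc) (v ∘ suc) ⊕ lincomb r (l′ ∘ suc) (v ∘ suc))
    ≡⟨ ⊕.interchange _ _ _ _ ⟩
  lincomb (suc r) l v ⊕ lincomb (suc r) l′ v ∎
  where open ≡-Reasoning

lincomb-unit : ∀ {n} r (i : Fin r) (v : Fin r → V n) → lincomb r (unit i) v ≡ v i
lincomb-unit (suc r) zero    v =
  trans (cong (v zero ⊕_) (lincomb-zero r (v ∘ suc) (λ _ → refl))) (⊕.identityʳ (v zero))
lincomb-unit (suc r) (suc i) v = trans (⊕.identityˡ _) (lincomb-unit r i (v ∘ suc))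

lincomb-translate : ∀ {n} r (l : Fin r → Bool) (a : V n) (v : Fin r → V n) →
  lincomb r l (λ i → a ⊕ v i) ≡ select (parity l) a ⊕ lincomb r l v
lincomb-translate zero    l a v = sym (⊕.identityˡ 0̂)
lincomb-translate (suc r) l a v = begin
  select (l zero) (a ⊕ v zero) ⊕ lincomb r (l ∘ suc) (λ i → a ⊕ v (suc i))
    ≡⟨ cong₂ _⊕_ (select-⊕ (l zero) a (v zero)) (lincomb-translate r (l ∘ suc) a (v ∘ suc)) ⟩
  (select (l zero) a ⊕ select (l zero) (v zero)) ⊕ (select (parity (l ∘ suc)) a ⊕ lincomb r (l ∘ suc) (v ∘ suc))
    ≡⟨ ⊕.interchange _ _ _ _ ⟩
  (select (l zero) a ⊕ select (parity (l ∘ suc)) a) ⊕ lincomb (suc r) l v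
    ≡⟨ cong (_⊕ lincomb (suc r) l v) (sym (select-xor (l zero) (parity (l ∘ suc)) a)) ⟩
  select (parity l) a ⊕ lincomb (suc r) l v ∎
  where open ≡-Reasoning

compose : ∀ s r → (Fin s → Bool) → (Fin s → Fin r → Bool) → Fin r → Bool
compose zero    r l m j = false
compose (suc s) r l m j = (l zero ∧ m zero j) xor compose s r (l ∘ suc) (m ∘ suc) j

select-lincomb : ∀ {n} r b (m : Fin r → Bool) (w : Fin r → V n) →
  select b (lincomb r m w) ≡ lincomb r (λ j → b ∧ m j) w
select-lincomb r true  m w = refl
select-lincomb r false m w = sym (lincomb-zero r w (λ _ → refl))

lincomb-compose : ∀ {n} s r (l : Fin s → Bool) (m : Fin s → Fin r → Bool) (w : Fin r → V n) →
  lincomb s l (λ i → lincomb r (m i) w) ≡ lincomb r (compose s r l m) w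
lincomb-compose zero    r l m w = sym (lincomb-zero r w (λ _ → refl))
lincomb-compose (suc s) r l m w = begin
  select (l zero) (lincomb r (m zero) w) ⊕ lincomb s (l ∘ suc) (λ i → lincomb r (m (suc i)) w)
    ≡⟨ cong₂ _⊕_ (select-lincomb r (l zero) (m zero) w) (lincomb-compose s r (l ∘ suc) (m ∘ suc) w) ⟩
  lincomb r (λ j → l zero ∧ m zero j) w ⊕ lincomb r (compose s r (l ∘ suc) (m ∘ suc)) w
    ≡⟨ sym (lincomb-⊻ r _ _ w) ⟩
  lincomb r (compose (suc s) r l m) w ∎
  where open ≡-Reasoning

flat-difference : ∀ {n} r {p : V n} {w : Fin r → V n} {m m′ x x′} →
  x ≡ p ⊕ lincomb r m w → x′ ≡ p ⊕ lincomb r m′ w → x ⊕ x′ ≡ lincomb r (m ⊻ m′) w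
flat-difference r {p} {w} {m} {m′} {x} {x′} x≡ x′≡ = begin
  x ⊕ x′                                           ≡⟨ cong₂ _⊕_ x≡ x′≡ ⟩
  (p ⊕ lincomb r m w) ⊕ (p ⊕ lincomb r m′ w)       ≡⟨ ⊕.interchange p _ p _ ⟩
  (p ⊕ p) ⊕ (lincomb r m w ⊕ lincomb r m′ w)       ≡⟨ cong (_⊕ _) (⊕-inverse p) ⟩
  0̂ ⊕ (lincomb r m w ⊕ lincomb r m′ w)             ≡⟨ ⊕.identityˡ _ ⟩
  lincomb r m w ⊕ lincomb r m′ w                   ≡⟨ sym (lincomb-⊻ r m m′ w) ⟩
  lincomb r (m ⊻ m′) w                             ∎
  where open ≡-Reasoning

LinIndep⇒lincomb-injective : ∀ {n} s {v : Fin s → V n} → LinIndep s v →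
  ∀ {l l′} → lincomb s l v ≡ lincomb s l′ v → ∀ i → l i ≡ l′ i
LinIndep⇒lincomb-injective s {v} indep {l} {l′} eq i = xor≡false⇒≡ (indep (l ⊻ l′) sum≡0 i)
  where
  sum≡0 : lincomb s (l ⊻ l′) v ≡ 0̂
  sum≡0 = trans (lincomb-⊻ s l l′ v) (trans (cong (_⊕ lincomb s l′ v) eq) (⊕-inverse _))

bitToFin : Bool → Fin 2
bitToFin false = zero
bitToFin true  = suc zero

finToBit : Fin 2 → Bool
finToBit zero       = false
finToBit (suc zero) = true

finToBit∘bitToFin : ∀ b → finToBit (bitToFin b) ≡ b
finToBit∘bitToFin false = refl
finToBit∘bitToFin true  = refl

bitToFin∘finToBit : ∀ i → bitToFin (finToBit i) ≡ i
bitToFin∘finToBit zero       = refl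
bitToFin∘finToBit (suc zero) = refl

funToFin-cong : ∀ {m n} {f g : Fin m → Fin n} → (∀ i → f i ≡ g i) → funToFin f ≡ funToFin g
funToFin-cong {zero}  eq = refl
funToFin-cong {suc m} eq = cong₂ combine (eq zero) (funToFin-cong (eq ∘ suc))

-- Pigeonhole: the 2ˢ combinations of v are distinct, but lie among the 2ʳ combinations of w.
LinIndep-≤ : ∀ {n} s r {v : Fin s → V n} {w : Fin r → V n} → LinIndep s v →
  (∀ i → ∃ λ m → v i ≡ lincomb r m w) → s ≤ r
LinIndep-≤ s r {v} {w} indep inSpan = ≮⇒≥ collision
  where
  coefficients : Fin (2 ^ s) → Fin s → Bool
  coefficients t = finToBit ∘ finToFun t

  coefficients-injective : ∀ {t t′} → (∀ i → coefficients t i ≡ coefficients t′ i) → t ≡ t′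
  coefficients-injective {t} {t′} eq = begin
    t                              ≡⟨ sym (funToFin-finToFin {s} {2} t) ⟩
    funToFin (finToFun {2} {s} t)  ≡⟨ funToFin-cong (λ i → begin
      finToFun t i                   ≡⟨ sym (bitToFin∘finToBit _) ⟩
      bitToFin (coefficients t i)    ≡⟨ cong bitToFin (eq i) ⟩
      bitToFin (coefficients t′ i)   ≡⟨ bitToFin∘finToBit _ ⟩
      finToFun t′ i                  ∎) ⟩
    funToFin (finToFun {2} {s} t′) ≡⟨ funToFin-finToFin {s} {2} t′ ⟩
    t′                             ∎
    where open ≡-Reasoning

  code : (Fin r → Bool) → Fin (2 ^ r)
  code m = funToFin (bitToFin ∘ m)

  code-injective : ∀ {m m′} → code m ≡ code m′ → ∀ j → m j ≡ m′ j
  code-injective {m} {m′} eq j = begin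
    m j                                  ≡⟨ sym (finToBit∘bitToFin (m j)) ⟩
    finToBit (bitToFin (m j))            ≡⟨ cong finToBit (sym (finToFun-funToFin (bitToFin ∘ m) j)) ⟩
    finToBit (finToFun (code m) j)       ≡⟨ cong (λ t → finToBit (finToFun t j)) eq ⟩
    finToBit (finToFun (code m′) j)      ≡⟨ cong finToBit (finToFun-funToFin (bitToFin ∘ m′) j) ⟩
    finToBit (bitToFin (m′ j))           ≡⟨ finToBit∘bitToFin (m′ j) ⟩
    m′ j                                 ∎
    where open ≡-Reasoning

  coordinates : (Fin s → Bool) → Fin r → Bool
  coordinates l = compose s r l (proj₁ ∘ inSpan)

  lincomb≡coordinates : ∀ l → lincomb s l v ≡ lincomb r (coordinates l) w
  lincomb≡coordinates l =
    trans (lincomb-congᵥ s l (proj₂ ∘ inSpan)) (lincomb-compose s r l (proj₁ ∘ inSpan) w)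

  collision : ¬ (r < s)
  collision r<s with pigeonhole (^-monoʳ-< 2 (s≤s (s≤s z≤n)) r<s) (code ∘ coordinates ∘ coefficients)
  ... | t , t′ , t<t′ , eq = <⇒≢ t<t′ (coefficients-injective (LinIndep⇒lincomb-injective s indep
        (trans (lincomb≡coordinates _) (trans (lincomb-cong r w (code-injective eq))
          (sym (lincomb≡coordinates _))))))

Unique⇒lookup-injective : ∀ {A : Set} {xs : List A} → Unique xs →
  ∀ i j → lookup xs i ≡ lookup xs j → i ≡ j
Unique⇒lookup-injective (_ ∷ _) zero zero _ = refl
Unique⇒lookup-injective (x∉xs ∷ _) zero (suc j) eq = ⊥-elim (All.lookup x∉xs (∈-lookup j) eq)
Unique⇒lookup-injective (x∉xs ∷ _) (suc i) zero eq = ⊥-elim (All.lookup x∉xs (∈-lookup i) (sym eq))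
Unique⇒lookup-injective (_ ∷ u) (suc i) (suc j) eq = cong suc (Unique⇒lookup-injective u i j eq)

length-filter-map : ∀ {A B : Set} {P : Pred A 0ℓ} {Q : Pred B 0ℓ} (P? : Decidable P) (Q? : Decidable Q)
  (g : B → A) → (∀ x → P (g x) → Q x) → (∀ x → Q x → P (g x)) →
  ∀ xs → length (filter P? (map g xs)) ≡ length (filter Q? xs)
length-filter-map P? Q? g P⇒Q Q⇒P [] = refl
length-filter-map P? Q? g P⇒Q Q⇒P (x ∷ xs) with P? (g x) | Q? x
... | yes _  | yes _  = cong suc (length-filter-map P? Q? g P⇒Q Q⇒P xs)
... | yes p  | no ¬q  = ⊥-elim (¬q (P⇒Q x p))
... | no ¬p  | yes q  = ⊥-elim (¬p (Q⇒P x q))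
... | no _   | no _   = length-filter-map P? Q? g P⇒Q Q⇒P xs

sum₃ : ∀ {n} → V n × V n × V n → V n
sum₃ (a , b , c) = a ⊕ b ⊕ c

multiplicity-reindex : ∀ {n} {B : Set} {Q : Pred B 0ℓ} (Q? : Decidable Q) (S : List (V n)) p
  (g : B → V n × V n × V n) xs → triples S ≡ map g xs →
  (∀ t → sum₃ (g t) ≡ p → Q t) → (∀ t → Q t → sum₃ (g t) ≡ p) →
  multiplicity S p ≡ length (filter Q? xs)
multiplicity-reindex Q? S p g xs triples≡ ⇒Q Q⇒ rewrite triples≡ = length-filter-map _ Q? g ⇒Q Q⇒ xs

vertex : Fin 6 → Fin 5 → Bool
vertex zero    = λ _ → true
vertex (suc i) = unit i

vertex-sum : Fin 6 × Fin 6 × Fin 6 → Fin 5 → Bool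
vertex-sum (i , j , k) = vertex i ⊻ vertex j ⊻ vertex k

count-triples-summing-to : (Fin 5 → Bool) → ℕ
count-triples-summing-to target =
  length (filter (λ t → all? λ m → vertex-sum t m B.≟ target m) (triples (allFin 6)))

triple-sum-multiplicity : ∀ i j k → i ≢ j → i ≢ k → j ≢ k →
  count-triples-summing-to (vertex-sum (i , j , k)) ≡ 2
triple-sum-multiplicity i j k i≢j i≢k j≢k =
  [ ⊥-elim ∘ i≢j , [ ⊥-elim ∘ i≢k , [ ⊥-elim ∘ j≢k , (λ two → two) ]′ ]′ ]′ (table i j k)
  where
  table : ∀ i j k → i ≡ j ⊎ i ≡ k ⊎ j ≡ k ⊎ count-triples-summing-to (vertex-sum (i , j , k)) ≡ 2
  table = toWitness {a? = all? λ i → all? λ j → all? λ k →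
    i F.≟ j ⊎-dec i F.≟ k ⊎-dec j F.≟ k ⊎-dec count-triples-summing-to (vertex-sum (i , j , k)) N.≟ 2} tt

unit≢all-ones : ∀ (i : Fin 5) → ¬ (∀ m → true ≡ unit i m)
unit≢all-ones = toWitness {a? = all? λ i → ¬? (all? λ m → true B.≟ unit i m)} tt

unit-triple≢all-ones : ∀ (i j k : Fin 5) → ¬ (∀ m → true ≡ (unit i ⊻ unit j ⊻ unit k) m)
unit-triple≢all-ones = toWitness
  {a? = all? λ i → all? λ j → all? λ k → ¬? (all? λ m → true B.≟ (unit i ⊻ unit j ⊻ unit k) m)} tt

module FivePointCap {n} (c₀ c₁ c₂ c₃ c₄ : V n)
  (unique : Unique (c₀ ∷ c₁ ∷ c₂ ∷ c₃ ∷ c₄ ∷ []))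
  (cap : IsCap ⟦ c₀ ∷ c₁ ∷ c₂ ∷ c₃ ∷ c₄ ∷ [] ⟧) where

  C : List (V n)
  C = c₀ ∷ c₁ ∷ c₂ ∷ c₃ ∷ c₄ ∷ []

  c : Fin 5 → V n
  c = lookup C

  y : V n
  y = sumL C

  σ : (Fin 5 → Bool) → V n
  σ l = lincomb 5 l c

  σ-⊻ : ∀ u w → σ (u ⊻ w) ≡ σ u ⊕ σ w
  σ-⊻ u w = lincomb-⊻ 5 u w c

  σ-unit : ∀ i → σ (unit i) ≡ c i
  σ-unit i = lincomb-unit 5 i c

  σ-unit-pair : ∀ i j → σ (unit i ⊻ unit j) ≡ c i ⊕ c j
  σ-unit-pair i j = trans (σ-⊻ (unit i) (unit j)) (cong₂ _⊕_ (σ-unit i) (σ-unit j))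

  σ-unit-triple : ∀ i j k → σ (unit i ⊻ unit j ⊻ unit k) ≡ c i ⊕ c j ⊕ c k
  σ-unit-triple i j k = trans (σ-⊻ (unit i ⊻ unit j) (unit k)) (cong₂ _⊕_ (σ-unit-pair i j) (σ-unit k))

  c-injective : ∀ {i j} → i ≢ j → c i ≢ c j
  c-injective i≢j = i≢j ∘ Unique⇒lookup-injective unique _ _

  ∈C⇒σ-unit : ∀ {x} (x∈C : x ∈ C) → x ≡ σ (unit (Any.index x∈C))
  ∈C⇒σ-unit x∈C = trans (lookup-index x∈C) (sym (σ-unit (Any.index x∈C)))

  pair-nonzero : ∀ i j → i ≢ j → σ (unit i ⊻ unit j) ≢ 0̂
  pair-nonzero i j i≢j σ≡0 =
    c-injective i≢j (⊕.inverseˡ-unique (c i) (c j) (trans (sym (σ-unit-pair i j)) σ≡0))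

  quad-nonzero : ∀ i j k m → i ≢ j → i ≢ k → i ≢ m → j ≢ k → j ≢ m → k ≢ m →
    σ (unit i ⊻ unit j ⊻ unit k ⊻ unit m) ≢ 0̂
  quad-nonzero i j k m i≢j i≢k i≢m j≢k j≢m k≢m σ≡0 =
    cap (c i) (c j) (c k) (c m) (∈-lookup i) (∈-lookup j) (∈-lookup k) (∈-lookup m)
      ( c-injective i≢j , c-injective i≢k , c-injective i≢m
      , c-injective j≢k , c-injective j≢m , c-injective k≢m
      , (begin
          c i ⊕ c j ⊕ c k ⊕ c m                    ≡⟨ sym (cong₂ _⊕_ (σ-unit-triple i j k) (σ-unit m)) ⟩
          σ (unit i ⊻ unit j ⊻ unit k) ⊕ σ (unit m) ≡⟨ sym (σ-⊻ (unit i ⊻ unit j ⊻ unit k) (unit m)) ⟩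
          σ (unit i ⊻ unit j ⊻ unit k ⊻ unit m)     ≡⟨ σ≡0 ⟩
          0̂                                         ∎))
    where open ≡-Reasoning

  direction : Fin 4 → V n
  direction i = c₀ ⊕ c (suc i)

  even : (Fin 4 → Bool) → Fin 5 → Bool
  even l = parity l ◂ l

  -- A nonzero even combination involves two or four points: excluded by distinctness and by the cap property.
  even-kernel : ∀ (v : Vec Bool 4) → σ (even (Vec.lookup v)) ≡ 0̂ → v ≡ Vec.replicate 4 false
  even-kernel (false ∷ false ∷ false ∷ false ∷ []) σ≡0 = refl
  even-kernel (false ∷ false ∷ false ∷ true  ∷ []) σ≡0 = ⊥-elim (pair-nonzero (# 0) (# 4) (λ ()) σ≡0)
  even-kernel (false ∷ false ∷ true  ∷ false ∷ []) σ≡0 = ⊥-elim (pair-nonzero (# 0) (# 3) (λ ()) σ≡0)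
  even-kernel (false ∷ false ∷ true  ∷ true  ∷ []) σ≡0 = ⊥-elim (pair-nonzero (# 3) (# 4) (λ ()) σ≡0)
  even-kernel (false ∷ true  ∷ false ∷ false ∷ []) σ≡0 = ⊥-elim (pair-nonzero (# 0) (# 2) (λ ()) σ≡0)
  even-kernel (false ∷ true  ∷ false ∷ true  ∷ []) σ≡0 = ⊥-elim (pair-nonzero (# 2) (# 4) (λ ()) σ≡0)
  even-kernel (false ∷ true  ∷ true  ∷ false ∷ []) σ≡0 = ⊥-elim (pair-nonzero (# 2) (# 3) (λ ()) σ≡0)
  even-kernel (false ∷ true  ∷ true  ∷ true  ∷ []) σ≡0 =
    ⊥-elim (quad-nonzero (# 0) (# 2) (# 3) (# 4) (λ ()) (λ ()) (λ ()) (λ ()) (λ ()) (λ ()) σ≡0)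
  even-kernel (true  ∷ false ∷ false ∷ false ∷ []) σ≡0 = ⊥-elim (pair-nonzero (# 0) (# 1) (λ ()) σ≡0)
  even-kernel (true  ∷ false ∷ false ∷ true  ∷ []) σ≡0 = ⊥-elim (pair-nonzero (# 1) (# 4) (λ ()) σ≡0)
  even-kernel (true  ∷ false ∷ true  ∷ false ∷ []) σ≡0 = ⊥-elim (pair-nonzero (# 1) (# 3) (λ ()) σ≡0)
  even-kernel (true  ∷ false ∷ true  ∷ true  ∷ []) σ≡0 =
    ⊥-elim (quad-nonzero (# 0) (# 1) (# 3) (# 4) (λ ()) (λ ()) (λ ()) (λ ()) (λ ()) (λ ()) σ≡0)
  even-kernel (true  ∷ true  ∷ false ∷ false ∷ []) σ≡0 = ⊥-elim (pair-nonzero (# 1) (# 2) (λ ()) σ≡0)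
  even-kernel (true  ∷ true  ∷ false ∷ true  ∷ []) σ≡0 =
    ⊥-elim (quad-nonzero (# 0) (# 1) (# 2) (# 4) (λ ()) (λ ()) (λ ()) (λ ()) (λ ()) (λ ()) σ≡0)
  even-kernel (true  ∷ true  ∷ true  ∷ false ∷ []) σ≡0 =
    ⊥-elim (quad-nonzero (# 0) (# 1) (# 2) (# 3) (λ ()) (λ ()) (λ ()) (λ ()) (λ ()) (λ ()) σ≡0)
  even-kernel (true  ∷ true  ∷ true  ∷ true  ∷ []) σ≡0 =
    ⊥-elim (quad-nonzero (# 1) (# 2) (# 3) (# 4) (λ ()) (λ ()) (λ ()) (λ ()) (λ ()) (λ ()) σ≡0)

  directions-independent : LinIndep 4 direction
  directions-independent l sum≡0 i = begin
    l i                                 ≡⟨ sym (lookup∘tabulate l i) ⟩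
    Vec.lookup (Vec.tabulate l) i       ≡⟨ cong (λ v → Vec.lookup v i) (even-kernel (Vec.tabulate l) σ≡0) ⟩
    Vec.lookup (Vec.replicate 4 false) i ≡⟨ lookup-replicate i false ⟩
    false                               ∎
    where
    open ≡-Reasoning
    l′ = Vec.lookup (Vec.tabulate l)
    σ≡0 : σ (even l′) ≡ 0̂
    σ≡0 = trans (sym (lincomb-translate 4 l′ c₀ (c ∘ suc)))
                (trans (lincomb-cong 4 direction (lookup∘tabulate l)) sum≡0)

  even-relation-trivial : ∀ {e} → parity e ≡ false → σ e ≡ 0̂ → ∀ k → e k ≡ false
  even-relation-trivial {e} even-e σ≡0 = kernel
    where
    e≗even : ∀ k → e k ≡ even (e ∘ suc) k
    e≗even zero    = xor≡false⇒≡ even-e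
    e≗even (suc k) = refl
    tail≡0 : ∀ k → e (suc k) ≡ false
    tail≡0 = directions-independent (e ∘ suc)
      (trans (lincomb-translate 4 (e ∘ suc) c₀ (c ∘ suc)) (trans (sym (lincomb-cong 5 c e≗even)) σ≡0))
    kernel : ∀ k → e k ≡ false
    kernel zero    = trans (e≗even zero) (parity-cong tail≡0)
    kernel (suc k) = tail≡0 k

  σ-injective : ∀ {u w} → parity u ≡ parity w → σ u ≡ σ w → ∀ k → u k ≡ w k
  σ-injective {u} {w} same-parity σu≡σw k = xor≡false⇒≡ (even-relation-trivial {u ⊻ w}
    (trans (parity-⊻ u w) (trans (cong (_xor parity w) same-parity) (xor-same (parity w))))
    (trans (σ-⊻ u w) (trans (cong (_⊕ σ w) σu≡σw) (⊕-inverse (σ w)))) k)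

  σ-⊻₃ : ∀ u v w → σ (u ⊻ v ⊻ w) ≡ σ u ⊕ σ v ⊕ σ w
  σ-⊻₃ u v w = trans (σ-⊻ (u ⊻ v) w) (cong (_⊕ σ w) (σ-⊻ u v))

  qc∪y : Subset n
  qc∪y x = qc ⟦ C ⟧ x ⊎ x ≡ y

  single : ∀ i → qc∪y (σ (unit i))
  single i = inj₁ (inj₁ (subst (_∈ C) (sym (σ-unit i)) (∈-lookup i)))

  triple : ∀ i j k → i ≢ j → i ≢ k → j ≢ k → qc∪y (σ (unit i ⊻ unit j ⊻ unit k))
  triple i j k i≢j i≢k j≢k = inj₁ (inj₂ (c i , c j , c k , ∈-lookup i , ∈-lookup j , ∈-lookup k ,
    c-injective i≢j , c-injective i≢k , c-injective j≢k , sym (σ-unit-triple i j k)))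

  odd : (Fin 4 → Bool) → Fin 5 → Bool
  odd l = not (parity l) ◂ l

  odd-point∈qc∪y : ∀ (v : Vec Bool 4) → qc∪y (σ (odd (Vec.lookup v)))
  odd-point∈qc∪y (false ∷ false ∷ false ∷ false ∷ []) = single (# 0)
  odd-point∈qc∪y (false ∷ false ∷ false ∷ true  ∷ []) = single (# 4)
  odd-point∈qc∪y (false ∷ false ∷ true  ∷ false ∷ []) = single (# 3)
  odd-point∈qc∪y (false ∷ false ∷ true  ∷ true  ∷ []) = triple (# 0) (# 3) (# 4) (λ ()) (λ ()) (λ ())
  odd-point∈qc∪y (false ∷ true  ∷ false ∷ false ∷ []) = single (# 2)
  odd-point∈qc∪y (false ∷ true  ∷ false ∷ true  ∷ []) = triple (# 0) (# 2) (# 4) (λ ()) (λ ()) (λ ())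
  odd-point∈qc∪y (false ∷ true  ∷ true  ∷ false ∷ []) = triple (# 0) (# 2) (# 3) (λ ()) (λ ()) (λ ())
  odd-point∈qc∪y (false ∷ true  ∷ true  ∷ true  ∷ []) = triple (# 2) (# 3) (# 4) (λ ()) (λ ()) (λ ())
  odd-point∈qc∪y (true  ∷ false ∷ false ∷ false ∷ []) = single (# 1)
  odd-point∈qc∪y (true  ∷ false ∷ false ∷ true  ∷ []) = triple (# 0) (# 1) (# 4) (λ ()) (λ ()) (λ ())
  odd-point∈qc∪y (true  ∷ false ∷ true  ∷ false ∷ []) = triple (# 0) (# 1) (# 3) (λ ()) (λ ()) (λ ())
  odd-point∈qc∪y (true  ∷ false ∷ true  ∷ true  ∷ []) = triple (# 1) (# 3) (# 4) (λ ()) (λ ()) (λ ())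
  odd-point∈qc∪y (true  ∷ true  ∷ false ∷ false ∷ []) = triple (# 0) (# 1) (# 2) (λ ()) (λ ()) (λ ())
  odd-point∈qc∪y (true  ∷ true  ∷ false ∷ true  ∷ []) = triple (# 1) (# 2) (# 4) (λ ()) (λ ()) (λ ())
  odd-point∈qc∪y (true  ∷ true  ∷ true  ∷ false ∷ []) = triple (# 1) (# 2) (# 3) (λ ()) (λ ()) (λ ())
  odd-point∈qc∪y (true  ∷ true  ∷ true  ∷ true  ∷ []) = inj₂ refl

  flat-point : ∀ l → c₀ ⊕ lincomb 4 l direction ≡ σ (odd l)
  flat-point l = trans (cong (c₀ ⊕_) (lincomb-translate 4 l c₀ (c ∘ suc))) (shift (parity l) _)
    where
    shift : ∀ b z → c₀ ⊕ (select b c₀ ⊕ z) ≡ select (not b) c₀ ⊕ z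
    shift true  z = trans (sym (⊕.assoc c₀ c₀ z)) (cong (_⊕ z) (⊕-inverse c₀))
    shift false z = cong (c₀ ⊕_) (⊕.identityˡ z)

  indicator₃ : ∀ {a b d} → a ∈ C → b ∈ C → d ∈ C → Fin 5 → Bool
  indicator₃ a∈C b∈C d∈C = unit (Any.index a∈C) ⊻ unit (Any.index b∈C) ⊻ unit (Any.index d∈C)

  parity-indicator₃ : ∀ {a b d} (a∈C : a ∈ C) (b∈C : b ∈ C) (d∈C : d ∈ C) →
    parity (indicator₃ a∈C b∈C d∈C) ≡ true
  parity-indicator₃ a∈C b∈C d∈C =
    parity-odd₃ (unit (Any.index a∈C)) (unit (Any.index b∈C)) (unit (Any.index d∈C))
      (parity-unit (Any.index a∈C)) (parity-unit (Any.index b∈C)) (parity-unit (Any.index d∈C))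

  exc-point : ∀ {a b d} (a∈C : a ∈ C) (b∈C : b ∈ C) (d∈C : d ∈ C) →
    a ⊕ b ⊕ d ≡ σ (indicator₃ a∈C b∈C d∈C)
  exc-point a∈C b∈C d∈C =
    trans (cong₂ _⊕_ (cong₂ _⊕_ (∈C⇒σ-unit a∈C) (∈C⇒σ-unit b∈C)) (∈C⇒σ-unit d∈C))
          (sym (σ-⊻₃ (unit (Any.index a∈C)) (unit (Any.index b∈C)) (unit (Any.index d∈C))))

  qc∪y⇒odd : ∀ {x} → qc∪y x → ∃ λ w → parity w ≡ true × x ≡ σ w
  qc∪y⇒odd (inj₁ (inj₁ x∈C)) = unit (Any.index x∈C) , parity-unit (Any.index x∈C) , ∈C⇒σ-unit x∈C
  qc∪y⇒odd (inj₁ (inj₂ (a , b , d , a∈C , b∈C , d∈C , _ , _ , _ , sum))) =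
    indicator₃ a∈C b∈C d∈C , parity-indicator₃ a∈C b∈C d∈C , trans (sym sum) (exc-point a∈C b∈C d∈C)
  qc∪y⇒odd (inj₂ x≡y) = (λ _ → true) , refl , x≡y

  qc∪y-isFlat : IsFlat 4 qc∪y
  qc∪y-isFlat = c₀ , direction , directions-independent , λ x → qc∪y⇒flat , flat⇒qc∪y
    where
    qc∪y⇒flat : ∀ {x} → qc∪y x → ∃ λ l → x ≡ c₀ ⊕ lincomb 4 l direction
    qc∪y⇒flat x∈qc∪y with w , odd-w , x≡σw ← qc∪y⇒odd x∈qc∪y =
      w ∘ suc , trans x≡σw (trans (lincomb-cong 5 c w≗odd) (sym (flat-point (w ∘ suc))))
      where
      w≗odd : ∀ k → w k ≡ odd (w ∘ suc) k
      w≗odd zero    = xor≡true⇒≡not odd-w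
      w≗odd (suc k) = refl
    flat⇒qc∪y : ∀ {x} → (∃ λ l → x ≡ c₀ ⊕ lincomb 4 l direction) → qc∪y x
    flat⇒qc∪y {x} (l , x≡) = subst qc∪y (sym x≡σ) (odd-point∈qc∪y (Vec.tabulate l))
      where
      l′ = Vec.lookup (Vec.tabulate l)
      x≡σ : x ≡ σ (odd l′)
      x≡σ = trans x≡ (trans (cong (c₀ ⊕_) (lincomb-cong 4 {l′ = l′} direction (sym ∘ lookup∘tabulate l)))
                            (flat-point l′))

  y∉qc : ¬ qc ⟦ C ⟧ y
  y∉qc (inj₁ y∈C) =
    unit≢all-ones (Any.index y∈C) (σ-injective (sym (parity-unit (Any.index y∈C))) (∈C⇒σ-unit y∈C))
  y∉qc (inj₂ (a , b , d , a∈C , b∈C , d∈C , _ , _ , _ , sum)) =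
    unit-triple≢all-ones (Any.index a∈C) (Any.index b∈C) (Any.index d∈C)
      (σ-injective (sym (parity-indicator₃ a∈C b∈C d∈C)) (trans (sym sum) (exc-point a∈C b∈C d∈C)))

  Y : List (V n)
  Y = y ∷ C

  ∈Y⇒∈C : ∀ {a} → a ∈ Y → a ≢ y → a ∈ C
  ∈Y⇒∈C (here a≡y)  a≢y = ⊥-elim (a≢y a≡y)
  ∈Y⇒∈C (there a∈C) _   = a∈C

  quad-through-y : ∀ {a b d} → a ∈ Y → b ∈ Y → d ∈ Y → ¬ IsQuad a b d y
  quad-through-y a∈Y b∈Y d∈Y (a≢b , a≢d , a≢y , b≢d , b≢y , d≢y , sum) =
    y∉qc (inj₂ (_ , _ , _ , ∈Y⇒∈C a∈Y a≢y , ∈Y⇒∈C b∈Y b≢y , ∈Y⇒∈C d∈Y d≢y , a≢b , a≢d , b≢d ,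
                ⊕.inverseˡ-unique _ y sum))

  Y-isCap : IsCap ⟦ Y ⟧
  Y-isCap a b d e (there a∈C) (there b∈C) (there d∈C) (there e∈C) = cap a b d e a∈C b∈C d∈C e∈C
  Y-isCap a b d e a∈Y b∈Y d∈Y (here refl) = quad-through-y a∈Y b∈Y d∈Y
  Y-isCap a b d e a∈Y b∈Y (here refl) e∈Y = quad-through-y a∈Y b∈Y e∈Y ∘ IsQuad-swapʳ
  Y-isCap a b d e a∈Y (here refl) d∈Y e∈Y = quad-through-y d∈Y e∈Y a∈Y ∘ IsQuad-rotate ∘ IsQuad-rotate
  Y-isCap a b d e (here refl) b∈Y d∈Y e∈Y = quad-through-y b∈Y d∈Y e∈Y ∘ IsQuad-rotate

  not-complete : ¬ IsComplete C
  not-complete complete = complete y (y∉qc ∘ inj₁) Y-isCap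

  not-in-smaller-flat : ¬ (Σ ℕ λ r → r < 4 × Σ (Subset n) λ F → IsFlat r F × All F C)
  not-in-smaller-flat (r , r<4 , F , (p , w , _ , F⇔span) , C⊆F) =
    ≤⇒≯ (LinIndep-≤ 4 r directions-independent direction∈span) r<4
    where
    coordinates : ∀ i → ∃ λ m → c i ≡ p ⊕ lincomb r m w
    coordinates i = proj₁ (F⇔span (c i)) (All.lookup C⊆F (∈-lookup i))
    direction∈span : ∀ i → ∃ λ m → direction i ≡ lincomb r m w
    direction∈span i with m₀ , c₀≡ ← coordinates zero | m , cᵢ≡ ← coordinates (suc i) =
      m₀ ⊻ m , flat-difference r c₀≡ cᵢ≡

  σ-vertex : ∀ t → σ (vertex t) ≡ lookup Y t
  σ-vertex zero    = refl
  σ-vertex (suc i) = σ-unit i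

  parity-vertex : ∀ t → parity (vertex t) ≡ true
  parity-vertex zero    = refl
  parity-vertex (suc i) = parity-unit i

  σ-vertex-sum : ∀ i j k → σ (vertex-sum (i , j , k)) ≡ lookup Y i ⊕ lookup Y j ⊕ lookup Y k
  σ-vertex-sum i j k =
    trans (σ-⊻₃ (vertex i) (vertex j) (vertex k))
          (cong₂ _⊕_ (cong₂ _⊕_ (σ-vertex i) (σ-vertex j)) (σ-vertex k))

  parity-vertex-sum : ∀ i j k → parity (vertex-sum (i , j , k)) ≡ true
  parity-vertex-sum i j k =
    parity-odd₃ (vertex i) (vertex j) (vertex k) (parity-vertex i) (parity-vertex j) (parity-vertex k)

  index-≢ : ∀ {a b} (a∈Y : a ∈ Y) (b∈Y : b ∈ Y) → a ≢ b → Any.index a∈Y ≢ Any.index b∈Y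
  index-≢ a∈Y b∈Y a≢b eq =
    a≢b (trans (lookup-index a∈Y) (trans (cong (lookup Y) eq) (sym (lookup-index b∈Y))))

  multiplicity-two : ∀ p → exc ⟦ Y ⟧ p → multiplicity Y p ≡ 2
  multiplicity-two p (a , b , d , a∈Y , b∈Y , d∈Y , a≢b , a≢d , b≢d , sum) = begin
    multiplicity Y p
      ≡⟨ multiplicity-reindex (λ t → all? λ m → vertex-sum t m B.≟ vertex-sum (i₁ , i₂ , i₃) m) Y p
           points (triples (allFin 6)) refl
           (λ { (i , j , k) → sums-to-p⇒ i j k }) (λ { (i , j , k) → ⇒sums-to-p i j k }) ⟩
    count-triples-summing-to (vertex-sum (i₁ , i₂ , i₃))
      ≡⟨ triple-sum-multiplicity i₁ i₂ i₃ (index-≢ a∈Y b∈Y a≢b) (index-≢ a∈Y d∈Y a≢d) (index-≢ b∈Y d∈Y b≢d) ⟩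
    2 ∎
    where
    open ≡-Reasoning
    i₁ = Any.index a∈Y
    i₂ = Any.index b∈Y
    i₃ = Any.index d∈Y

    points : Fin 6 × Fin 6 × Fin 6 → V n × V n × V n
    points (i , j , k) = lookup Y i , lookup Y j , lookup Y k

    p≡σ : p ≡ σ (vertex-sum (i₁ , i₂ , i₃))
    p≡σ = trans (sym sum)
      (trans (cong₂ _⊕_ (cong₂ _⊕_ (lookup-index a∈Y) (lookup-index b∈Y)) (lookup-index d∈Y))
             (sym (σ-vertex-sum i₁ i₂ i₃)))

    sums-to-p⇒ : ∀ i j k → lookup Y i ⊕ lookup Y j ⊕ lookup Y k ≡ p →
      ∀ m → vertex-sum (i , j , k) m ≡ vertex-sum (i₁ , i₂ , i₃) m
    sums-to-p⇒ i j k sum≡p = σ-injective (trans (parity-vertex-sum i j k) (sym (parity-vertex-sum i₁ i₂ i₃)))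
                                         (trans (σ-vertex-sum i j k) (trans sum≡p p≡σ))

    ⇒sums-to-p : ∀ i j k → (∀ m → vertex-sum (i , j , k) m ≡ vertex-sum (i₁ , i₂ , i₃) m) →
      lookup Y i ⊕ lookup Y j ⊕ lookup Y k ≡ p
    ⇒sums-to-p i j k same = trans (sym (σ-vertex-sum i j k)) (trans (lincomb-cong 5 c same) (sym p≡σ))

theorem5p13 : ∀ {n} (C : List (V n)) → Unique C → length C ≡ 5 → IsCap ⟦ C ⟧ →
    ((IsFlat 4 (λ p → qc ⟦ C ⟧ p ⊎ p ≡ sumL C) × ¬ qc ⟦ C ⟧ (sumL C))
    × (¬ IsComplete C
       × ¬ (Σ ℕ λ r → r < 4 × Σ (Subset n) λ F → IsFlat r F × All F C))
    × (∀ p → exc ⟦ sumL C ∷ C ⟧ p → multiplicity (sumL C ∷ C) p ≡ 2))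
theorem5p13 (c₀ ∷ c₁ ∷ c₂ ∷ c₃ ∷ c₄ ∷ []) unique refl cap =
  (qc∪y-isFlat , y∉qc) , (not-complete , not-in-smaller-flat) , multiplicity-two
  where open FivePointCap c₀ c₁ c₂ c₃ c₄ unique cap
theorem5p13 []                          _ () _
theorem5p13 (_ ∷ [])                    _ () _
theorem5p13 (_ ∷ _ ∷ [])                _ () _
theorem5p13 (_ ∷ _ ∷ _ ∷ [])            _ () _
theorem5p13 (_ ∷ _ ∷ _ ∷ _ ∷ [])        _ () _
theorem5p13 (_ ∷ _ ∷ _ ∷ _ ∷ _ ∷ _ ∷ _) _ () _
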